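{- Let $\Gamma$ be a finite group, $A_1,\dots,A_k\subseteq\Gamma$ cubical generating sets, and $X=\mathrm{Cay}(\Gamma;(A_1,\dots,A_k))$. Let $U=\{(g_1,x_1),\dots,(g_m,x_m)\}\subseteq X(0)$, and define $S(U)=\{i\in[k]:\exists\, s,t\in[m]\text{ with }x_s[i]\ne x_t[i]\}=\bigcup_{t>1}\mathrm{supp}(x_t\oplus x_1)$ and the subcube $C(U)=\{x_1\oplus\bigoplus_{i\in S(U)}b_ie_i : b_i\in\{0,1\}\}$. Then there is at most one $C(U)$-face (element of $X(C(U))$) containing $U$, and if such a $C(U)$-face exists, the number of $k$-faces $f\in X(k)$ containing $U$ equals $\prod_{i\notin S(U)}|A_i|$.
   Context: For subsets $A,B$ of a group, $A\cdot B=\{ab:a\in A,b\in B\}$. Sets $A_1,\dots,A_k\subseteq\Gamma$ are cubical generating sets if each is closed under inverses, $A_i\cdot A_j=A_j\cdot A_i$ for all $i\ne j$, and $|A_1\cdots A_k|=|A_1|\cdots|A_k|$. The (decorated) Cayley cubical complex $X=\mathrm{Cay}(\Gamma;(A_1,\dots,A_k))$ has vertex set $X(0)=\Gamma\times\{0,1\}^k$ and $k$-faces $X(k)$ consisting of all $2^k$-element sets $f=\{(f_x,x)\}_{x\in\{0,1\}^k}$ with $f_x\in\Gamma$ such that $f_x^{ -1}f_{x\oplus e_i}\in A_i$ for every $x\in\{0,1\}^k$ and $i\in[k]$ ($e_i$ the $i$-th standard basis vector). For a subcube $C\subseteq\{0,1\}^k$ (a set of the form $\{y\oplus\bigoplus_{i\in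 I}b_ie_i: b_i\in\{0,1\}\}$ for some $y$ and $I\subseteq[k]$), $X(C)=\{\{(f_x,x)\}_{x\in C}: f\in X(k)\}$ is the set of $C$-faces. A face contains $U$ if $U$ is a subset of it. -}

module Defs where

open import Level using (0ℓ)
open import Data.Nat using (ℕ; zero; suc; _*_)
open import Data.Bool using (Bool; true; false; not; _xor_; if_then_else_)
import Data.Bool.Properties as BoolP
open import Data.Fin using (Fin; zero; suc)
open import Data.Fin.Properties using (any?; _≟_)
open import Data.Fin.Subset using (Subset; _∈_; ∣_∣; ⁅_⁆)
open import Data.Fin.Subset.Properties using (_∈?_)
open import Data.Vec using (Vec; lookup; tabulate; zipWith; updateAt)
open import Data.Product using (Σ; ∃; _×_; _,_; proj₁; proj₂)
open import Algebra.Core using (Op₁; Op₂)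
open import Algebra.Structures using (IsGroup)
open import Relation.Binary.PropositionalEquality
  using (_≡_; _≢_; refl; sym; trans)
open import Relation.Binary.Bundles using (Setoid)
open import Relation.Nullary using (¬?)
open import Relation.Nullary.Decidable using (⌊_⌋; _×-dec_)

-- A finite group, presented (up to isomorphism) on the carrier Fin n,
-- with propositional equality.
record FinGroup : Set where
  field
    n       : ℕ
    _∙_     : Op₂ (Fin n)
    ε       : Fin n
    _⁻¹     : Op₁ (Fin n)
    isGroup : IsGroup _≡_ _∙_ ε _⁻¹

∏ : ∀ {k} → (Fin k → ℕ) → ℕ
∏ {zero}  a = 1
∏ {suc k} a = a zero * ∏ (λ i → a (suc i))

flipAt : ∀ {k} → Vec Bool k → Fin k → Vec Bool k
flipAt x i = updateAt x i not

module _ (G : FinGroup) where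
  open FinGroup G

  _·_ : Subset n → Subset n → Subset n
  A · B = tabulate λ g →
    ⌊ any? (λ a → any? (λ b → (a ∈? A) ×-dec ((b ∈? B) ×-dec ((a ∙ b) ≟ g)))) ⌋

  InvClosed : Subset n → Set
  InvClosed A = ∀ g → g ∈ A → (g ⁻¹) ∈ A

  prodSets : ∀ {k} → (Fin k → Subset n) → Subset n
  prodSets {zero}  A = ⁅ ε ⁆
  prodSets {suc k} A = A zero · prodSets (λ i → A (suc i))

  record IsCubical (k : ℕ) (A : Fin k → Subset n) : Set where
    field
      inv-closed : ∀ i → InvClosed (A i)
      commute    : ∀ i j → i ≢ j → (A i · A j) ≡ (A j · A i)
      size       : ∣ prodSets A ∣ ≡ ∏ (λ i → ∣ A i ∣)

  -- A k-face {(f_x , x)}_{x ∈ {0,1}^k} is given by the map x ↦ f_x.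
  IsFace : ∀ {k} → (Fin k → Subset n) → (Vec Bool k → Fin n) → Set
  IsFace A f = ∀ x i → (((f x) ⁻¹) ∙ f (flipAt x i)) ∈ A i

  -- U = {(g_1,x_1),…,(g_m,x_m)} ⊆ X(0), m ≥ 1, listed as t ↦ (g_t , x_t)
  Vtx : ℕ → Set
  Vtx k = Fin n × Vec Bool k

  Contains : ∀ {k m} → (Vec Bool k → Fin n) → (Fin (suc m) → Vtx k) → Set
  Contains f U = ∀ t → f (proj₂ (U t)) ≡ proj₁ (U t)

  S : ∀ {k m} → (Fin (suc m) → Vtx k) → Subset k
  S U = tabulate λ i → ⌊ any? (λ s → any? (λ t →
          ¬? (lookup (proj₂ (U s)) i BoolP.≟ lookup (proj₂ (U t)) i))) ⌋

  InC : ∀ {k m} → (Fin (suc m) → Vtx k) → Vec Bool k → Set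
  InC U y = ∃ λ (b : Fin _ → Bool) → (∀ i → b i ≡ true → i ∈ S U)
              × (y ≡ zipWith _xor_ (proj₂ (U zero)) (tabulate b))

  -- the C(U)-face { (f_y , y) }_{y ∈ C(U)} (restriction of the k-face f) contains U
  CContains : ∀ {k m} → (Vec Bool k → Fin n) → (Fin (suc m) → Vtx k) → Set
  CContains f U = ∀ t → InC U (proj₂ (U t)) × (f (proj₂ (U t)) ≡ proj₁ (U t))

  SameCFace : ∀ {k m} → (Fin (suc m) → Vtx k) → (f f' : Vec Bool k → Fin n) → Set
  SameCFace U f f' = ∀ y → InC U y → f y ≡ f' y

  FacesContaining : ∀ {k m} → (Fin k → Subset n) → (Fin (suc m) → Vtx k) → Setoid 0ℓ 0ℓ
  FacesContaining {k} A U = record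
    { Carrier = Σ (Vec Bool k → Fin n) (λ f → IsFace A f × Contains f U)
    ; _≈_ = λ p q → ∀ x → proj₁ p x ≡ proj₁ q x
    ; isEquivalence = record
        { refl = λ x → refl
        ; sym = λ e x → sym (e x)
        ; trans = λ e e' x → trans (e x) (e' x) } }

  countOutsideS : ∀ {k m} → (Fin k → Subset n) → (Fin (suc m) → Vtx k) → ℕ
  countOutsideS A U = ∏ (λ i → if ⌊ i ∈? S U ⌋ then 1 else ∣ A i ∣)

{-# OPTIONS --safe #-}

-- Write P T for the product ∏_{i ∈ T} A i taken in increasing order of i, and ⊕ for coordinatewise
-- xor of cube vertices.  As the A i commute pairwise as sets, P Z = P X · P Y whenever Z is the
-- disjoint union of X and Y; with |P ⊤| = ∏ |A i| this forces unique factorisation in P T · P (∁ T)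
-- (and, all A i being nonempty, |P T| = ∏_{i ∈ T} |A i|).  Along a face f, f(x)⁻¹ f(y) ∈ P (x ⊕ y).
-- Uniqueness: if two faces agree at x and at y with x_i ≠ y_i, factorising the path
-- x → x ⊕ e_i → y shows that they agree at x ⊕ e_i; starting from the vertices of U this spreads
-- over all of C(U).  Counting: a face is determined by f(z) and γ = f(z)⁻¹ f(∁ z) ∈ P ⊤ (∁ z is the
-- antipode of z), namely f(x) = f(z) · (P (z ⊕ x)-factor of γ).  For z = x_1 and a face containing U,
-- the P (S(U))-factor of γ is fixed by the uniqueness part, while its P (∁ S(U))-factor ranges freely
-- over P (∁ S(U)), a set of size ∏_{i ∉ S(U)} |A i|.

module Submission where

open import Defs
open import Level using (0ℓ)
open import Algebra.Bundles using (Group)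
open import Algebra.Structures using (IsGroup)
import Algebra.Properties.Group as GroupProperties
import Algebra.Properties.CommutativeSemigroup as CommutativeSemigroupProperties
open import Data.Bool using (Bool; true; false; not; _xor_; if_then_else_)
open import Data.Bool.Properties using (not-involutive; not-¬; xor-comm; xor-identityʳ; T-≡)
  renaming (_≟_ to _≟ᵇ_)
open import Data.Fin using (Fin; zero; suc; punchOut; combine; remQuot)
open import Data.Fin.Properties
  using (any?; _≟_; suc-injective; injective⇒≤; punchOut-injective; combine-injective; remQuot-combine; nonZeroIndex)
open import Data.Fin.Subset using (Subset; _∈_; _⊆_; ∣_∣; ⁅_⁆; ∁; ⊤; ⊥; Nonempty)
open import Data.Fin.Subset.Properties using (_∈?_; drop-there; ⊆-refl; x∈⁅x⁆; x∈⁅y⁆⇒x≡y; ∣⁅x⁆∣≡1; p⊆q⇒∣p∣≤∣q∣)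
open import Data.Nat using (ℕ; zero; suc; _*_; _≤_; _<_; s≤s; NonZero)
open import Data.Nat.Properties
  using (≤-reflexive; ≤-trans; ≤-antisym; <-irrefl; *-mono-≤; *-monoʳ-≤; *-cancelʳ-≤; *-assoc;
         *-identityˡ; m*n≢0; *-commutativeSemigroup; module ≤-Reasoning)
open import Data.Product using (Σ; ∃; ∃₂; _×_; _,_; proj₁; proj₂)
open import Data.Vec using (Vec; []; _∷_; lookup; tabulate; zipWith; here; there)
open import Data.Vec.Properties
  using (updateAt-updateAt; updateAt-id-local; lookup∘updateAt; lookup∘tabulate; tabulate∘lookup;
         lookup⇒[]=; []=⇒lookup)
open import Data.Vec.Properties.WithK using ([]=-irrelevant)
open import Function using (_∘_; _$_; _⇔_; Inverse)
open import Function.Bundles using (Equivalence; mk⇔)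
open import Function.Definitions using (StrictlySurjective)
import Function.Construct.Composition as Compose
open import Relation.Binary.Bundles using (Setoid)
import Relation.Binary.Construct.On as On
open import Relation.Binary.PropositionalEquality
open import Relation.Nullary using (Dec; yes; no; contradiction; _×-dec_)
open import Relation.Nullary.Decidable using (⌊_⌋; toWitness; fromWitness; ⌊⌋-map′)

infixl 6 _⊕_
_⊕_ : ∀ {k} → Subset k → Subset k → Subset k
x ⊕ y = zipWith _xor_ x y

x⊕[x⊕y]≡y : ∀ {k} (x y : Subset k) → x ⊕ (x ⊕ y) ≡ y
x⊕[x⊕y]≡y []          []      = refl
x⊕[x⊕y]≡y (true ∷ x)  (b ∷ y) = cong₂ _∷_ (not-involutive b) (x⊕[x⊕y]≡y x y)
x⊕[x⊕y]≡y (false ∷ x) (b ∷ y) = cong (b ∷_) (x⊕[x⊕y]≡y x y)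

[x⊕y]⊕[x⊕z]≡y⊕z : ∀ {k} (x y z : Subset k) → (x ⊕ y) ⊕ (x ⊕ z) ≡ y ⊕ z
[x⊕y]⊕[x⊕z]≡y⊕z []          []      []      = refl
[x⊕y]⊕[x⊕z]≡y⊕z (false ∷ x) (b ∷ y) (c ∷ z) = cong ((b xor c) ∷_) ([x⊕y]⊕[x⊕z]≡y⊕z x y z)
[x⊕y]⊕[x⊕z]≡y⊕z (true ∷ x)  (b ∷ y) (c ∷ z) = cong₂ _∷_ (lemma b c) ([x⊕y]⊕[x⊕z]≡y⊕z x y z)
  where
  lemma : ∀ b c → not b xor not c ≡ b xor c
  lemma true  c = refl
  lemma false c = not-involutive c

x⊕∁y≡∁[y⊕x] : ∀ {k} (x y : Subset k) → x ⊕ ∁ y ≡ ∁ (y ⊕ x)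
x⊕∁y≡∁[y⊕x] []          []          = refl
x⊕∁y≡∁[y⊕x] (true ∷ x)  (true ∷ y)  = cong (true ∷_) (x⊕∁y≡∁[y⊕x] x y)
x⊕∁y≡∁[y⊕x] (true ∷ x)  (false ∷ y) = cong (false ∷_) (x⊕∁y≡∁[y⊕x] x y)
x⊕∁y≡∁[y⊕x] (false ∷ x) (true ∷ y)  = cong (false ∷_) (x⊕∁y≡∁[y⊕x] x y)
x⊕∁y≡∁[y⊕x] (false ∷ x) (false ∷ y) = cong (true ∷_) (x⊕∁y≡∁[y⊕x] x y)

x⊕∁x≡⊤ : ∀ {k} (x : Subset k) → x ⊕ ∁ x ≡ ⊤
x⊕∁x≡⊤ []          = refl
x⊕∁x≡⊤ (true ∷ x)  = cong (true ∷_) (x⊕∁x≡⊤ x)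
x⊕∁x≡⊤ (false ∷ x) = cong (true ∷_) (x⊕∁x≡⊤ x)

∁⊤≡⊥ : ∀ {k} → ∁ (⊤ {k}) ≡ ⊥
∁⊤≡⊥ {zero}  = refl
∁⊤≡⊥ {suc k} = cong (false ∷_) ∁⊤≡⊥

⊕-flipAt : ∀ {k} (x y : Subset k) i → x ⊕ flipAt y i ≡ flipAt (x ⊕ y) i
⊕-flipAt (true ∷ x)  (b ∷ y) zero    = refl
⊕-flipAt (false ∷ x) (b ∷ y) zero    = refl
⊕-flipAt (a ∷ x)     (b ∷ y) (suc i) = cong ((a xor b) ∷_) (⊕-flipAt x y i)

flipAt-involutive : ∀ {k} (x : Subset k) i → flipAt (flipAt x i) i ≡ x
flipAt-involutive x i = trans (updateAt-updateAt i x) (updateAt-id-local i x (not-involutive _))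

∈⊕⇒≢ : ∀ {k} {x y : Subset k} {i} → i ∈ x ⊕ y → lookup x i ≢ lookup y i
∈⊕⇒≢ {x = true ∷ x}  {false ∷ y} here = λ ()
∈⊕⇒≢ {x = false ∷ x} {true ∷ y}  here = λ ()
∈⊕⇒≢ {x = _ ∷ x}     {_ ∷ y}     (there i∈x⊕y) = ∈⊕⇒≢ i∈x⊕y

-- A ternary relation, not an equation: Z is the disjoint union of X and Y.
infix 4 _⊔_≡_
data _⊔_≡_ : ∀ {k} → Subset k → Subset k → Subset k → Set where
  []  : [] ⊔ [] ≡ []
  inˡ : ∀ {k} {X Y Z : Subset k} → X ⊔ Y ≡ Z → true ∷ X ⊔ false ∷ Y ≡ true ∷ Z
  inʳ : ∀ {k} {X Y Z : Subset k} → X ⊔ Y ≡ Z → false ∷ X ⊔ true ∷ Y ≡ true ∷ Z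
  out : ∀ {k} {X Y Z : Subset k} → X ⊔ Y ≡ Z → false ∷ X ⊔ false ∷ Y ≡ false ∷ Z

⊥⊔X≡X : ∀ {k} (X : Subset k) → ⊥ ⊔ X ≡ X
⊥⊔X≡X []          = []
⊥⊔X≡X (true ∷ X)  = inʳ (⊥⊔X≡X X)
⊥⊔X≡X (false ∷ X) = out (⊥⊔X≡X X)

X⊔⊥≡X : ∀ {k} (X : Subset k) → X ⊔ ⊥ ≡ X
X⊔⊥≡X []          = []
X⊔⊥≡X (true ∷ X)  = inˡ (X⊔⊥≡X X)
X⊔⊥≡X (false ∷ X) = out (X⊔⊥≡X X)

X⊔∁X≡⊤ : ∀ {k} (X : Subset k) → X ⊔ ∁ X ≡ ⊤
X⊔∁X≡⊤ []          = []
X⊔∁X≡⊤ (true ∷ X)  = inˡ (X⊔∁X≡⊤ X)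
X⊔∁X≡⊤ (false ∷ X) = inʳ (X⊔∁X≡⊤ X)

⊔-∁ : ∀ {k} {X Y Z : Subset k} → X ⊔ Y ≡ Z → Y ⊔ ∁ Z ≡ ∁ X
⊔-∁ []      = []
⊔-∁ (inˡ d) = out (⊔-∁ d)
⊔-∁ (inʳ d) = inˡ (⊔-∁ d)
⊔-∁ (out d) = inʳ (⊔-∁ d)

X⊔⁅i⁆≡flipAt : ∀ {k} (X : Subset k) i → lookup X i ≡ false → X ⊔ ⁅ i ⁆ ≡ flipAt X i
X⊔⁅i⁆≡flipAt (false ∷ X) zero    refl = inʳ (X⊔⊥≡X X)
X⊔⁅i⁆≡flipAt (true ∷ X)  (suc i) Xi   = inˡ (X⊔⁅i⁆≡flipAt X i Xi)
X⊔⁅i⁆≡flipAt (false ∷ X) (suc i) Xi   = out (X⊔⁅i⁆≡flipAt X i Xi)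

⁅i⁆⊔[flipAt⊕]≡⊕ : ∀ {k} (x y : Subset k) i → lookup x i ≢ lookup y i → ⁅ i ⁆ ⊔ flipAt x i ⊕ y ≡ x ⊕ y
⁅i⁆⊔[flipAt⊕]≡⊕ (true ∷ x)  (true ∷ y)  zero    xi≢yi = contradiction refl xi≢yi
⁅i⁆⊔[flipAt⊕]≡⊕ (true ∷ x)  (false ∷ y) zero    _     = inˡ (⊥⊔X≡X (x ⊕ y))
⁅i⁆⊔[flipAt⊕]≡⊕ (false ∷ x) (true ∷ y)  zero    _     = inˡ (⊥⊔X≡X (x ⊕ y))
⁅i⁆⊔[flipAt⊕]≡⊕ (false ∷ x) (false ∷ y) zero    xi≢yi = contradiction refl xi≢yi
⁅i⁆⊔[flipAt⊕]≡⊕ (true ∷ x)  (true ∷ y)  (suc i) xi≢yi = out (⁅i⁆⊔[flipAt⊕]≡⊕ x y i xi≢yi)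
⁅i⁆⊔[flipAt⊕]≡⊕ (true ∷ x)  (false ∷ y) (suc i) xi≢yi = inʳ (⁅i⁆⊔[flipAt⊕]≡⊕ x y i xi≢yi)
⁅i⁆⊔[flipAt⊕]≡⊕ (false ∷ x) (true ∷ y)  (suc i) xi≢yi = inʳ (⁅i⁆⊔[flipAt⊕]≡⊕ x y i xi≢yi)
⁅i⁆⊔[flipAt⊕]≡⊕ (false ∷ x) (false ∷ y) (suc i) xi≢yi = out (⁅i⁆⊔[flipAt⊕]≡⊕ x y i xi≢yi)

⊆⇒X⊔[X⊕Y]≡Y : ∀ {k} {X Y : Subset k} → X ⊆ Y → X ⊔ X ⊕ Y ≡ Y
⊆⇒X⊔[X⊕Y]≡Y {X = []}     {[]}       X⊆Y = []
⊆⇒X⊔[X⊕Y]≡Y {X = true ∷ X}  {true ∷ Y}  X⊆Y = inˡ (⊆⇒X⊔[X⊕Y]≡Y (λ x∈X → drop-there (X⊆Y (there x∈X))))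
⊆⇒X⊔[X⊕Y]≡Y {X = true ∷ X}  {false ∷ Y} X⊆Y with () ← X⊆Y here
⊆⇒X⊔[X⊕Y]≡Y {X = false ∷ X} {true ∷ Y}  X⊆Y = inʳ (⊆⇒X⊔[X⊕Y]≡Y (λ x∈X → drop-there (X⊆Y (there x∈X))))
⊆⇒X⊔[X⊕Y]≡Y {X = false ∷ X} {false ∷ Y} X⊆Y = out (⊆⇒X⊔[X⊕Y]≡Y (λ x∈X → drop-there (X⊆Y (there x∈X))))

FlipClosed : ∀ {k} → (Subset k → Set) → Set
FlipClosed E = ∀ {x y} i → E x → E y → lookup x i ≢ lookup y i → E (flipAt x i)

flipClosed-⊕ : ∀ {k} {E : Subset k → Set} → FlipClosed E →
               ∀ {z} D → E z → (∀ {i} → i ∈ D → E (flipAt z i)) → E (z ⊕ D)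
flipClosed-⊕ closed {[]} [] Ez _ = Ez
flipClosed-⊕ {E = E} closed {c ∷ z} (false ∷ D) Ez neighbour =
  subst (λ b → E (b ∷ z ⊕ D)) (sym (xor-identityʳ c)) $
  flipClosed-⊕ {E = E ∘ (c ∷_)} (λ i → closed (suc i)) D Ez (neighbour ∘ there)
flipClosed-⊕ {E = E} closed {c ∷ z} (true ∷ D) Ez neighbour =
  subst (λ b → E (b ∷ z ⊕ D)) (xor-comm true c) $
  flipClosed-⊕ {E = E ∘ (not c ∷_)} (λ i → closed (suc i)) D (neighbour here) neighbour′
  where
  -- flipAt z zero and flipAt z (suc i) are opposite corners of a square
  neighbour′ : ∀ {i} → i ∈ D → E (not c ∷ flipAt z i)
  neighbour′ {i} i∈D = closed (suc i) (neighbour here) (neighbour (there i∈D))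
    (λ eq → not-¬ refl (trans eq (lookup∘updateAt i z)))

∈tabulate⌊⌋⇔ : ∀ {n} {P : Fin n → Set} (P? : ∀ i → Dec (P i)) {i} →
               i ∈ tabulate (λ j → ⌊ P? j ⌋) ⇔ P i
∈tabulate⌊⌋⇔ P? {i} = mk⇔
  (λ i∈ → toWitness (Equivalence.from T-≡ (trans (sym (lookup∘tabulate _ i)) ([]=⇒lookup i∈))))
  (λ p → lookup⇒[]= i _ (trans (lookup∘tabulate _ i) (Equivalence.to T-≡ (fromWitness p))))

∈-resp-≡ : ∀ {n} {p : Subset n} {x y} → x ≡ y → x ∈ p → y ∈ p
∈-resp-≡ refl x∈p = x∈p

elementAt : ∀ {n} (p : Subset n) → Fin ∣ p ∣ → Fin n
elementAt (true ∷ p)  zero    = zero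
elementAt (true ∷ p)  (suc i) = suc (elementAt p i)
elementAt (false ∷ p) i       = suc (elementAt p i)

elementAt∈ : ∀ {n} (p : Subset n) i → elementAt p i ∈ p
elementAt∈ (true ∷ p)  zero    = here
elementAt∈ (true ∷ p)  (suc i) = there (elementAt∈ p i)
elementAt∈ (false ∷ p) i       = there (elementAt∈ p i)

indexOf : ∀ {n} (p : Subset n) {x} → x ∈ p → Fin ∣ p ∣
indexOf (true ∷ p)  here        = zero
indexOf (true ∷ p)  (there x∈p) = suc (indexOf p x∈p)
indexOf (false ∷ p) (there x∈p) = indexOf p x∈p

elementAt-indexOf : ∀ {n} (p : Subset n) {x} (x∈p : x ∈ p) → elementAt p (indexOf p x∈p) ≡ x
elementAt-indexOf (true ∷ p)  here        = refl
elementAt-indexOf (true ∷ p)  (there x∈p) = cong suc (elementAt-indexOf p x∈p)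
elementAt-indexOf (false ∷ p) (there x∈p) = cong suc (elementAt-indexOf p x∈p)

indexOf-elementAt : ∀ {n} (p : Subset n) i (x∈p : elementAt p i ∈ p) → indexOf p x∈p ≡ i
indexOf-elementAt (true ∷ p)  zero    here        = refl
indexOf-elementAt (true ∷ p)  (suc i) (there x∈p) = cong suc (indexOf-elementAt p i x∈p)
indexOf-elementAt (false ∷ p) i       (there x∈p) = indexOf-elementAt p i x∈p

indexOf-cong : ∀ {n} (p : Subset n) {x y} → x ≡ y → (x∈p : x ∈ p) (y∈p : y ∈ p) →
               indexOf p x∈p ≡ indexOf p y∈p
indexOf-cong p refl x∈p y∈p = cong (indexOf p) ([]=-irrelevant x∈p y∈p)

Members : ∀ {n} → Subset n → Setoid 0ℓ 0ℓ
Members {n} p = On.setoid {B = ∃ (_∈ p)} (setoid (Fin n)) proj₁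

Fin∣p∣↔Members : ∀ {n} (p : Subset n) → Inverse (setoid (Fin ∣ p ∣)) (Members p)
Fin∣p∣↔Members p = record
  { to        = λ i → elementAt p i , elementAt∈ p i
  ; from      = λ x → indexOf p (proj₂ x)
  ; to-cong   = cong (elementAt p)
  ; from-cong = λ {x} {y} x≡y → indexOf-cong p x≡y (proj₂ x) (proj₂ y)
  ; inverse   = (λ { refl → elementAt-indexOf p _ })
              , (λ {i} {y} y≡ → trans (indexOf-cong p y≡ (proj₂ y) (elementAt∈ p i))
                                      (indexOf-elementAt p i _))
  }

surjective⇒≤ : ∀ {N M} {h : Fin N → Fin M} → StrictlySurjective _≡_ h → M ≤ N
surjective⇒≤ {h = h} surj = injective⇒≤ {f = proj₁ ∘ surj}
  (λ {u} {v} eq → trans (sym (proj₂ (surj u))) (trans (cong h eq) (proj₂ (surj v))))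

surjective∧collision⇒< : ∀ {N M} {h : Fin N → Fin M} → StrictlySurjective _≡_ h →
                         ∀ {x y} → x ≢ y → h x ≡ h y → M < N
surjective∧collision⇒< {suc N} {M} {h} surj {x} {y} x≢y hx≡hy =
  s≤s (injective⇒≤ {f = punchedSection} injective)
  where
  -- a section of h avoiding x: wherever it would pick x, pick y instead
  section : ∀ u → ∃ λ w → x ≢ w × h w ≡ u
  section u with proj₁ (surj u) ≟ x
  ... | yes w≡x = y , x≢y , trans (sym hx≡hy) (trans (cong h (sym w≡x)) (proj₂ (surj u)))
  ... | no w≢x  = proj₁ (surj u) , w≢x ∘ sym , proj₂ (surj u)
  punchedSection : Fin M → Fin N
  punchedSection u = punchOut (proj₁ (proj₂ (section u)))
  injective : ∀ {u v} → punchedSection u ≡ punchedSection v → u ≡ v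
  injective {u} {v} eq = trans (sym (proj₂ (proj₂ (section u))))
    (trans (cong h (punchOut-injective (proj₁ (proj₂ (section u))) (proj₁ (proj₂ (section v))) eq))
           (proj₂ (proj₂ (section v))))

∏On : ∀ {k} → (Fin k → ℕ) → Subset k → ℕ
∏On a []          = 1
∏On a (true ∷ T)  = a zero * ∏On (a ∘ suc) T
∏On a (false ∷ T) = ∏On (a ∘ suc) T

∏On-∁ : ∀ {k} (a : Fin k → ℕ) T → ∏On a T * ∏On a (∁ T) ≡ ∏ a
∏On-∁ a []          = refl
∏On-∁ a (true ∷ T)  = trans (*-assoc (a zero) _ _) (cong (a zero *_) (∏On-∁ (a ∘ suc) T))
∏On-∁ a (false ∷ T) = trans (x∙yz≈y∙xz (∏On (a ∘ suc) T) (a zero) _) (cong (a zero *_) (∏On-∁ (a ∘ suc) T))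
  where open CommutativeSemigroupProperties *-commutativeSemigroup using (x∙yz≈y∙xz)

∏-cong : ∀ {k} {a b : Fin k → ℕ} → (∀ i → a i ≡ b i) → ∏ a ≡ ∏ b
∏-cong {zero}  a≡b = refl
∏-cong {suc k} a≡b = cong₂ _*_ (a≡b zero) (∏-cong (a≡b ∘ suc))

∏-if-suc∈? : ∀ {k} (a : Fin (suc k) → ℕ) t T →
             ∏ (λ i → if ⌊ suc i ∈? t ∷ T ⌋ then 1 else a (suc i)) ≡ ∏ (λ i → if ⌊ i ∈? T ⌋ then 1 else a (suc i))
∏-if-suc∈? a t T = ∏-cong λ i → cong (if_then 1 else a (suc i)) (⌊⌋-map′ there drop-there (i ∈? T))

∏-if-∈≡∏On∁ : ∀ {k} (a : Fin k → ℕ) T → ∏ (λ i → if ⌊ i ∈? T ⌋ then 1 else a i) ≡ ∏On a (∁ T)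
∏-if-∈≡∏On∁ a []          = refl
∏-if-∈≡∏On∁ a (true ∷ T)  = trans (*-identityˡ _) (trans (∏-if-suc∈? a true T) (∏-if-∈≡∏On∁ (a ∘ suc) T))
∏-if-∈≡∏On∁ a (false ∷ T) = cong (a zero *_) (trans (∏-if-suc∈? a false T) (∏-if-∈≡∏On∁ (a ∘ suc) T))

∏On-nonZero : ∀ {k} (a : Fin k → ℕ) → (∀ i → NonZero (a i)) → ∀ T → NonZero (∏On a T)
∏On-nonZero a a≢0 []          = _
∏On-nonZero a a≢0 (true ∷ T)  = m*n≢0 (a zero) _ {{a≢0 zero}} {{∏On-nonZero (a ∘ suc) (a≢0 ∘ suc) T}}
∏On-nonZero a a≢0 (false ∷ T) = ∏On-nonZero (a ∘ suc) (a≢0 ∘ suc) T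

module _ (G : FinGroup) where
  open FinGroup G
  open IsGroup isGroup using (assoc; identityˡ; identityʳ; inverseˡ; _\\_)

  private
    group : Group 0ℓ 0ℓ
    group = record { isGroup = isGroup }

  open GroupProperties group
    using (∙-cancelˡ; \\-leftDividesˡ; \\-leftDividesʳ; ⁻¹-anti-homo-∙; ⁻¹-anti-homo-\\)

  \\-chain : ∀ x y z → (x \\ y) ∙ (y \\ z) ≡ x \\ z
  \\-chain x y z = trans (assoc (x ⁻¹) y (y \\ z)) (cong ((x ⁻¹) ∙_) (\\-leftDividesˡ y z))

  ∙-\\-∙ : ∀ g x y → (g ∙ x) \\ (g ∙ y) ≡ x \\ y
  ∙-\\-∙ g x y = begin
    (g ∙ x) \\ (g ∙ y)            ≡⟨ cong (_∙ (g ∙ y)) (⁻¹-anti-homo-∙ g x) ⟩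
    ((x ⁻¹) ∙ (g ⁻¹)) ∙ (g ∙ y)  ≡⟨ assoc (x ⁻¹) (g ⁻¹) (g ∙ y) ⟩
    (x ⁻¹) ∙ (g \\ (g ∙ y))      ≡⟨ cong ((x ⁻¹) ∙_) (\\-leftDividesʳ g y) ⟩
    x \\ y                       ∎
    where open ≡-Reasoning

  ∈·⇔ : ∀ {B C g} → g ∈ _·_ G B C ⇔ (∃₂ λ b c → b ∈ B × c ∈ C × b ∙ c ≡ g)
  ∈·⇔ = ∈tabulate⌊⌋⇔ _

  ∙∈· : ∀ {B C b c} → b ∈ B → c ∈ C → b ∙ c ∈ _·_ G B C
  ∙∈· b∈B c∈C = Equivalence.from ∈·⇔ (_ , _ , b∈B , c∈C , refl)

  ∈·⇒ : ∀ {B C g} → g ∈ _·_ G B C → ∃₂ λ b c → b ∈ B × c ∈ C × b ∙ c ≡ g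
  ∈·⇒ = Equivalence.to ∈·⇔

  module _ (B C : Subset n) where
    private
      BC : Subset n
      BC = _·_ G B C

      multiply′ : Fin ∣ B ∣ × Fin ∣ C ∣ → Fin ∣ BC ∣
      multiply′ (i , j) = indexOf BC (∙∈· (elementAt∈ B i) (elementAt∈ C j))

      multiply : Fin (∣ B ∣ * ∣ C ∣) → Fin ∣ BC ∣
      multiply = multiply′ ∘ remQuot ∣ C ∣

      multiply-combine : ∀ {b c} (b∈B : b ∈ B) (c∈C : c ∈ C) (bc∈BC : b ∙ c ∈ BC) →
                         multiply (combine (indexOf B b∈B) (indexOf C c∈C)) ≡ indexOf BC bc∈BC
      multiply-combine b∈B c∈C bc∈BC =
        trans (cong multiply′ (remQuot-combine (indexOf B b∈B) (indexOf C c∈C)))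
              (indexOf-cong BC (cong₂ _∙_ (elementAt-indexOf B b∈B) (elementAt-indexOf C c∈C)) _ bc∈BC)

      multiply-surjective : StrictlySurjective _≡_ multiply
      multiply-surjective u with b , c , b∈B , c∈C , bc≡u ← ∈·⇒ (elementAt∈ BC u) =
        combine (indexOf B b∈B) (indexOf C c∈C) ,
        trans (multiply-combine b∈B c∈C (∙∈· b∈B c∈C))
              (trans (indexOf-cong BC bc≡u _ (elementAt∈ BC u)) (indexOf-elementAt BC u _))

    ∣·∣≤∣∣*∣∣ : ∣ _·_ G B C ∣ ≤ ∣ B ∣ * ∣ C ∣
    ∣·∣≤∣∣*∣∣ = surjective⇒≤ multiply-surjective

    ·-factorˡ-unique : ∣ _·_ G B C ∣ ≡ ∣ B ∣ * ∣ C ∣ →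
                       ∀ {b b′ c c′} → b ∈ B → b′ ∈ B → c ∈ C → c′ ∈ C → b ∙ c ≡ b′ ∙ c′ → b ≡ b′
    ·-factorˡ-unique ∣BC∣≡ {b} {b′} b∈B b′∈B c∈C c′∈C bc≡b′c′ with b ≟ b′
    ... | yes b≡b′ = b≡b′
    ... | no b≢b′  =
      contradiction (surjective∧collision⇒< multiply-surjective distinct collide) (<-irrefl ∣BC∣≡)
      where
      distinct : combine (indexOf B b∈B) (indexOf C c∈C) ≢ combine (indexOf B b′∈B) (indexOf C c′∈C)
      distinct eq = b≢b′ (trans (sym (elementAt-indexOf B b∈B))
        (trans (cong (elementAt B) (proj₁ (combine-injective _ _ _ _ eq))) (elementAt-indexOf B b′∈B)))
      collide : multiply (combine (indexOf B b∈B) (indexOf C c∈C))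
              ≡ multiply (combine (indexOf B b′∈B) (indexOf C c′∈C))
      collide = trans (multiply-combine b∈B c∈C (∙∈· b∈B c∈C))
        (trans (indexOf-cong BC bc≡b′c′ _ _) (sym (multiply-combine b′∈B c′∈C (∙∈· b′∈B c′∈C))))

  Commutes : Subset n → Subset n → Set
  Commutes B C = ∀ {b c} → b ∈ B → c ∈ C → ∃₂ λ c′ b′ → c′ ∈ C × b′ ∈ B × b ∙ c ≡ c′ ∙ b′

  commutes-⁅ε⁆ˡ : ∀ {C} → Commutes ⁅ ε ⁆ C
  commutes-⁅ε⁆ˡ {b = b} {c} b∈⁅ε⁆ c∈C rewrite x∈⁅y⁆⇒x≡y ε b∈⁅ε⁆ =
    c , ε , c∈C , x∈⁅x⁆ ε , trans (identityˡ c) (sym (identityʳ c))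

  commutes-⁅ε⁆ʳ : ∀ {B} → Commutes B ⁅ ε ⁆
  commutes-⁅ε⁆ʳ {b = b} {c} b∈B c∈⁅ε⁆ rewrite x∈⁅y⁆⇒x≡y ε c∈⁅ε⁆ =
    ε , b , x∈⁅x⁆ ε , b∈B , trans (identityʳ b) (sym (identityˡ b))

  commutes-·ˡ : ∀ {B C D} → Commutes B D → Commutes C D → Commutes (_·_ G B C) D
  commutes-·ˡ BD CD {c = d} bc∈BC d∈D
    with b , c , b∈B , c∈C , refl ← ∈·⇒ bc∈BC
    with d′ , c′ , d′∈D , c′∈C , cd≡d′c′ ← CD c∈C d∈D
    with d″ , b′ , d″∈D , b′∈B , bd′≡d″b′ ← BD b∈B d′∈D
    = d″ , b′ ∙ c′ , d″∈D , ∙∈· b′∈B c′∈C , (begin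
      (b ∙ c) ∙ d    ≡⟨ assoc b c d ⟩
      b ∙ (c ∙ d)    ≡⟨ cong (b ∙_) cd≡d′c′ ⟩
      b ∙ (d′ ∙ c′)  ≡⟨ sym (assoc b d′ c′) ⟩
      (b ∙ d′) ∙ c′  ≡⟨ cong (_∙ c′) bd′≡d″b′ ⟩
      (d″ ∙ b′) ∙ c′ ≡⟨ assoc d″ b′ c′ ⟩
      d″ ∙ (b′ ∙ c′) ∎)
    where open ≡-Reasoning

  commutes-·ʳ : ∀ {B C D} → Commutes B C → Commutes B D → Commutes B (_·_ G C D)
  commutes-·ʳ BC BD {b = b} b∈B cd∈CD
    with c , d , c∈C , d∈D , refl ← ∈·⇒ cd∈CD
    with c′ , b′ , c′∈C , b′∈B , bc≡c′b′ ← BC b∈B c∈C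
    with d′ , b″ , d′∈D , b″∈B , b′d≡d′b″ ← BD b′∈B d∈D
    = c′ ∙ d′ , b″ , ∙∈· c′∈C d′∈D , b″∈B , (begin
      b ∙ (c ∙ d)    ≡⟨ sym (assoc b c d) ⟩
      (b ∙ c) ∙ d    ≡⟨ cong (_∙ d) bc≡c′b′ ⟩
      (c′ ∙ b′) ∙ d  ≡⟨ assoc c′ b′ d ⟩
      c′ ∙ (b′ ∙ d)  ≡⟨ cong (c′ ∙_) b′d≡d′b″ ⟩
      c′ ∙ (d′ ∙ b″) ≡⟨ sym (assoc c′ d′ b″) ⟩
      (c′ ∙ d′) ∙ b″ ∎)
    where open ≡-Reasoning

  PairwiseCommuting : ∀ {k} → (Fin k → Subset n) → Set
  PairwiseCommuting A = ∀ i j → i ≢ j → Commutes (A i) (A j)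

  prodSetsOn : ∀ {k} → (Fin k → Subset n) → Subset k → Subset n
  prodSetsOn A []          = ⁅ ε ⁆
  prodSetsOn A (true ∷ T)  = _·_ G (A zero) (prodSetsOn (A ∘ suc) T)
  prodSetsOn A (false ∷ T) = prodSetsOn (A ∘ suc) T

  prodSetsOn-⊤ : ∀ {k} (A : Fin k → Subset n) → prodSetsOn A ⊤ ≡ prodSets G A
  prodSetsOn-⊤ {zero}  A = refl
  prodSetsOn-⊤ {suc k} A = cong (_·_ G (A zero)) (prodSetsOn-⊤ (A ∘ suc))

  prodSetsOn-⊥ : ∀ {k} (A : Fin k → Subset n) → prodSetsOn A ⊥ ≡ ⁅ ε ⁆
  prodSetsOn-⊥ {zero}  A = refl
  prodSetsOn-⊥ {suc k} A = prodSetsOn-⊥ (A ∘ suc)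

  ε∈prodSetsOn-⊥ : ∀ {k} (A : Fin k → Subset n) → ε ∈ prodSetsOn A ⊥
  ε∈prodSetsOn-⊥ A = subst (ε ∈_) (sym (prodSetsOn-⊥ A)) (x∈⁅x⁆ ε)

  ∈prodSetsOn-⁅⁆⇔ : ∀ {k} (A : Fin k → Subset n) i {a} → a ∈ prodSetsOn A ⁅ i ⁆ ⇔ a ∈ A i
  ∈prodSetsOn-⁅⁆⇔ A (suc i) = ∈prodSetsOn-⁅⁆⇔ (A ∘ suc) i
  ∈prodSetsOn-⁅⁆⇔ A zero {a} = mk⇔
    (λ a∈ → let b , c , b∈ , c∈ , bc≡a = ∈·⇒ a∈ in
      ∈-resp-≡ (trans (sym (identityʳ b)) (trans (cong (b ∙_) (sym (∈ε c∈))) bc≡a)) b∈)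
    (λ a∈ → ∈-resp-≡ (identityʳ a) (∙∈· a∈ (ε∈prodSetsOn-⊥ (A ∘ suc))))
    where
    ∈ε : ∀ {c} → c ∈ prodSetsOn (A ∘ suc) ⊥ → c ≡ ε
    ∈ε c∈ = x∈⁅y⁆⇒x≡y ε (subst (_ ∈_) (prodSetsOn-⊥ (A ∘ suc)) c∈)

  prodSetsOn-nonempty : ∀ {k} (A : Fin k → Subset n) → (∀ i → Nonempty (A i)) → ∀ T → Nonempty (prodSetsOn A T)
  prodSetsOn-nonempty A nonempty []          = ε , x∈⁅x⁆ ε
  prodSetsOn-nonempty A nonempty (true ∷ T)  =
    let a , a∈ = nonempty zero ; b , b∈ = prodSetsOn-nonempty (A ∘ suc) (nonempty ∘ suc) T
    in a ∙ b , ∙∈· a∈ b∈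
  prodSetsOn-nonempty A nonempty (false ∷ T) = prodSetsOn-nonempty (A ∘ suc) (nonempty ∘ suc) T

  ∣prodSetsOn∣≤∏On : ∀ {k} (A : Fin k → Subset n) T → ∣ prodSetsOn A T ∣ ≤ ∏On (∣_∣ ∘ A) T
  ∣prodSetsOn∣≤∏On A []          = ≤-reflexive (∣⁅x⁆∣≡1 ε)
  ∣prodSetsOn∣≤∏On A (true ∷ T)  =
    ≤-trans (∣·∣≤∣∣*∣∣ _ _) (*-monoʳ-≤ ∣ A zero ∣ (∣prodSetsOn∣≤∏On (A ∘ suc) T))
  ∣prodSetsOn∣≤∏On A (false ∷ T) = ∣prodSetsOn∣≤∏On (A ∘ suc) T

  commutes-prodSetsOnˡ : ∀ {k} (A : Fin k → Subset n) {B} → (∀ j → Commutes (A j) B) →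
                         ∀ T → Commutes (prodSetsOn A T) B
  commutes-prodSetsOnˡ A AB []          = commutes-⁅ε⁆ˡ
  commutes-prodSetsOnˡ A AB (true ∷ T)  = commutes-·ˡ (AB zero) (commutes-prodSetsOnˡ (A ∘ suc) (AB ∘ suc) T)
  commutes-prodSetsOnˡ A AB (false ∷ T) = commutes-prodSetsOnˡ (A ∘ suc) (AB ∘ suc) T

  commutes-prodSetsOnʳ : ∀ {k} (A : Fin k → Subset n) {B} → (∀ j → Commutes B (A j)) →
                         ∀ T → Commutes B (prodSetsOn A T)
  commutes-prodSetsOnʳ A BA []          = commutes-⁅ε⁆ʳ
  commutes-prodSetsOnʳ A BA (true ∷ T)  = commutes-·ʳ (BA zero) (commutes-prodSetsOnʳ (A ∘ suc) (BA ∘ suc) T)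
  commutes-prodSetsOnʳ A BA (false ∷ T) = commutes-prodSetsOnʳ (A ∘ suc) (BA ∘ suc) T

  module _ {k} {A : Fin (suc k) → Subset n} (commuting : PairwiseCommuting A) where
    pairwiseCommuting-suc : PairwiseCommuting (A ∘ suc)
    pairwiseCommuting-suc i j i≢j = commuting (suc i) (suc j) (i≢j ∘ suc-injective)

    commutes-tail-head : ∀ T → Commutes (prodSetsOn (A ∘ suc) T) (A zero)
    commutes-tail-head = commutes-prodSetsOnˡ (A ∘ suc) (λ j → commuting (suc j) zero λ ())

    commutes-head-tail : ∀ T → Commutes (A zero) (prodSetsOn (A ∘ suc) T)
    commutes-head-tail = commutes-prodSetsOnʳ (A ∘ suc) (λ j → commuting zero (suc j) λ ())

  ∙∈prodSetsOn-⊔ : ∀ {k} {A : Fin k → Subset n} → PairwiseCommuting A → ∀ {X Y Z} → X ⊔ Y ≡ Z →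
                   ∀ {a b} → a ∈ prodSetsOn A X → b ∈ prodSetsOn A Y → a ∙ b ∈ prodSetsOn A Z
  ∙∈prodSetsOn-⊔ commuting [] {a} {b} a∈ b∈
    rewrite x∈⁅y⁆⇒x≡y ε a∈ | x∈⁅y⁆⇒x≡y ε b∈ = ∈-resp-≡ (sym (identityˡ ε)) (x∈⁅x⁆ ε)
  ∙∈prodSetsOn-⊔ commuting (inˡ d) {b = b} a∈ b∈
    with a₀ , a₁ , a₀∈ , a₁∈ , refl ← ∈·⇒ a∈
    = ∈-resp-≡ (sym (assoc a₀ a₁ b)) (∙∈· a₀∈ (∙∈prodSetsOn-⊔ (pairwiseCommuting-suc commuting) d a₁∈ b∈))
  ∙∈prodSetsOn-⊔ commuting {false ∷ X} (inʳ d) {a} a∈ b∈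
    with b₀ , b₁ , b₀∈ , b₁∈ , refl ← ∈·⇒ b∈
    with b₀′ , a′ , b₀′∈ , a′∈ , ab₀≡b₀′a′ ← commutes-tail-head commuting X a∈ b₀∈
    = ∈-resp-≡ eq (∙∈· b₀′∈ (∙∈prodSetsOn-⊔ (pairwiseCommuting-suc commuting) d a′∈ b₁∈))
    where
    eq : b₀′ ∙ (a′ ∙ b₁) ≡ a ∙ (b₀ ∙ b₁)
    eq = trans (sym (assoc b₀′ a′ b₁)) (trans (cong (_∙ b₁) (sym ab₀≡b₀′a′)) (assoc a b₀ b₁))
  ∙∈prodSetsOn-⊔ commuting (out d) a∈ b∈ = ∙∈prodSetsOn-⊔ (pairwiseCommuting-suc commuting) d a∈ b∈

  ∈prodSetsOn-⊔⇒ : ∀ {k} {A : Fin k → Subset n} → PairwiseCommuting A → ∀ {X Y Z} → X ⊔ Y ≡ Z →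
                   ∀ {g} → g ∈ prodSetsOn A Z → ∃₂ λ a b → a ∈ prodSetsOn A X × b ∈ prodSetsOn A Y × a ∙ b ≡ g
  ∈prodSetsOn-⊔⇒ commuting [] {g} g∈ rewrite x∈⁅y⁆⇒x≡y ε g∈ = ε , ε , x∈⁅x⁆ ε , x∈⁅x⁆ ε , identityˡ ε
  ∈prodSetsOn-⊔⇒ commuting (inˡ d) g∈
    with g₀ , g₁ , g₀∈ , g₁∈ , refl ← ∈·⇒ g∈
    with a , b , a∈ , b∈ , ab≡g₁ ← ∈prodSetsOn-⊔⇒ (pairwiseCommuting-suc commuting) d g₁∈
    = g₀ ∙ a , b , ∙∈· g₀∈ a∈ , b∈ , trans (assoc g₀ a b) (cong (g₀ ∙_) ab≡g₁)
  ∈prodSetsOn-⊔⇒ commuting {false ∷ X} (inʳ d) g∈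
    with g₀ , g₁ , g₀∈ , g₁∈ , refl ← ∈·⇒ g∈
    with a , b , a∈ , b∈ , ab≡g₁ ← ∈prodSetsOn-⊔⇒ (pairwiseCommuting-suc commuting) d g₁∈
    with a′ , g₀′ , a′∈ , g₀′∈ , g₀a≡a′g₀′ ← commutes-head-tail commuting X g₀∈ a∈
    = a′ , g₀′ ∙ b , a′∈ , ∙∈· g₀′∈ b∈ , eq
    where
    eq : a′ ∙ (g₀′ ∙ b) ≡ g₀ ∙ g₁
    eq = trans (sym (assoc a′ g₀′ b))
               (trans (cong (_∙ b) (sym g₀a≡a′g₀′)) (trans (assoc g₀ a b) (cong (g₀ ∙_) ab≡g₁)))
  ∈prodSetsOn-⊔⇒ commuting (out d) g∈ = ∈prodSetsOn-⊔⇒ (pairwiseCommuting-suc commuting) d g∈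

  IsFace-slice : ∀ {k} {A : Fin (suc k) → Subset n} {f} → IsFace G A f →
                 ∀ c → IsFace G (A ∘ suc) (f ∘ (c ∷_))
  IsFace-slice F c x i = F (c ∷ x) (suc i)

  face⇒nonempty : ∀ {k} {A : Fin k → Subset n} {f} → IsFace G A f → ∀ i → Nonempty (A i)
  face⇒nonempty F i = _ , F ⊥ i

  face-\\∈prodSetsOn : ∀ {k} {A : Fin k → Subset n} {f} → IsFace G A f →
                      ∀ x y → f x \\ f y ∈ prodSetsOn A (x ⊕ y)
  face-crossing-\\∈ : ∀ {k} {A : Fin (suc k) → Subset n} {f} → IsFace G A f →
                     ∀ c x y → f (c ∷ x) \\ f (not c ∷ y) ∈ _·_ G (A zero) (prodSetsOn (A ∘ suc) (x ⊕ y))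

  face-\\∈prodSetsOn {f = f} F [] [] = ∈-resp-≡ (sym (inverseˡ (f []))) (x∈⁅x⁆ ε)
  face-\\∈prodSetsOn F (true ∷ x)  (true ∷ y)  = face-\\∈prodSetsOn (IsFace-slice F true) x y
  face-\\∈prodSetsOn F (false ∷ x) (false ∷ y) = face-\\∈prodSetsOn (IsFace-slice F false) x y
  face-\\∈prodSetsOn F (true ∷ x)  (false ∷ y) = face-crossing-\\∈ F true x y
  face-\\∈prodSetsOn F (false ∷ x) (true ∷ y)  = face-crossing-\\∈ F false x y

  face-crossing-\\∈ {f = f} F c x y = ∈-resp-≡ (\\-chain (f (c ∷ x)) (f (not c ∷ x)) (f (not c ∷ y)))
    (∙∈· (F (c ∷ x) zero) (face-\\∈prodSetsOn (IsFace-slice F (not c)) x y))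

  module Cubical {k} {A : Fin k → Subset n} (cubical : IsCubical G k A) where
    open IsCubical cubical

    private
      P : Subset k → Subset n
      P = prodSetsOn A

      ∣A∣ : Fin k → ℕ
      ∣A∣ = ∣_∣ ∘ A

    pairwiseCommuting : PairwiseCommuting A
    pairwiseCommuting i j i≢j {a} {b} a∈ b∈
      with b′ , a′ , b′∈ , a′∈ , b′a′≡ab ← ∈·⇒ (subst ((a ∙ b) ∈_) (commute i j i≢j) (∙∈· a∈ b∈))
      = b′ , a′ , b′∈ , a′∈ , sym b′a′≡ab

    ∏On≤∣P·P∁∣ : ∀ T → ∏On ∣A∣ T * ∏On ∣A∣ (∁ T) ≤ ∣ _·_ G (P T) (P (∁ T)) ∣
    ∏On≤∣P·P∁∣ T = begin
      ∏On ∣A∣ T * ∏On ∣A∣ (∁ T) ≡⟨ ∏On-∁ ∣A∣ T ⟩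
      ∏ ∣A∣                     ≡⟨ size ⟨
      ∣ prodSets G A ∣          ≡⟨ cong ∣_∣ (prodSetsOn-⊤ A) ⟨
      ∣ P ⊤ ∣                   ≤⟨ p⊆q⇒∣p∣≤∣q∣ P⊤⊆P·P∁ ⟩
      ∣ _·_ G (P T) (P (∁ T)) ∣ ∎
      where
      open ≤-Reasoning
      P⊤⊆P·P∁ : P ⊤ ⊆ _·_ G (P T) (P (∁ T))
      P⊤⊆P·P∁ g∈ with a , b , a∈ , b∈ , refl ← ∈prodSetsOn-⊔⇒ pairwiseCommuting (X⊔∁X≡⊤ T) g∈ = ∙∈· a∈ b∈

    ∣P·P∁∣≡∣P∣*∣P∁∣ : ∀ T → ∣ _·_ G (P T) (P (∁ T)) ∣ ≡ ∣ P T ∣ * ∣ P (∁ T) ∣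
    ∣P·P∁∣≡∣P∣*∣P∁∣ T = ≤-antisym (∣·∣≤∣∣*∣∣ _ _)
      (≤-trans (*-mono-≤ (∣prodSetsOn∣≤∏On A T) (∣prodSetsOn∣≤∏On A (∁ T))) (∏On≤∣P·P∁∣ T))

    prodSetsOn-factorˡ-unique : ∀ T {a a′ b b′} → a ∈ P T → a′ ∈ P T → b ∈ P (∁ T) → b′ ∈ P (∁ T) →
                                a ∙ b ≡ a′ ∙ b′ → a ≡ a′
    prodSetsOn-factorˡ-unique T = ·-factorˡ-unique _ _ (∣P·P∁∣≡∣P∣*∣P∁∣ T)

    -- The P T-factor of γ ∈ P T · P (∁ T), unique by prodSetsOn-factorˡ-unique.
    component : Subset k → Fin n → Fin n
    component T γ with any? (λ a → a ∈? P T ×-dec (a \\ γ) ∈? P (∁ T))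
    ... | yes (a , _) = a
    ... | no _        = ε

    component-∙ : ∀ T {a b} → a ∈ P T → b ∈ P (∁ T) → component T (a ∙ b) ≡ a
    component-∙ T {a} {b} a∈ b∈ with any? (λ a′ → a′ ∈? P T ×-dec (a′ \\ (a ∙ b)) ∈? P (∁ T))
    ... | yes (a′ , a′∈ , a′\\ab∈) = prodSetsOn-factorˡ-unique T a′∈ a∈ a′\\ab∈ b∈ (\\-leftDividesˡ a′ (a ∙ b))
    ... | no ∄                     = contradiction (a , a∈ , ∈-resp-≡ (sym (\\-leftDividesʳ a b)) b∈) ∄

    component-⊤ : ∀ {γ} → γ ∈ P ⊤ → component ⊤ γ ≡ γ
    component-⊤ {γ} γ∈ = trans (cong (component ⊤) (sym (identityʳ γ)))
      (component-∙ ⊤ γ∈ (subst (λ T → ε ∈ P T) (sym ∁⊤≡⊥) (ε∈prodSetsOn-⊥ A)))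

    component-flipAt-∉ : ∀ T i → lookup T i ≡ false → ∀ {γ} → γ ∈ P ⊤ →
                         component T γ \\ component (flipAt T i) γ ∈ A i
    component-flipAt-∉ T i Ti≡false γ∈
      with a , b , a∈ , b∈ , refl ← ∈prodSetsOn-⊔⇒ pairwiseCommuting (X⊔∁X≡⊤ T) γ∈
      with a₁ , b₁ , a₁∈ , b₁∈ , refl ← ∈prodSetsOn-⊔⇒ pairwiseCommuting (⊔-∁ (X⊔⁅i⁆≡flipAt T i Ti≡false)) b∈
      = ∈-resp-≡ (sym a\\aa₁) (Equivalence.to (∈prodSetsOn-⁅⁆⇔ A i) a₁∈)
      where
      T⊔⁅i⁆ : T ⊔ ⁅ i ⁆ ≡ flipAt T i
      T⊔⁅i⁆ = X⊔⁅i⁆≡flipAt T i Ti≡false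
      a\\aa₁ : component T (a ∙ (a₁ ∙ b₁)) \\ component (flipAt T i) (a ∙ (a₁ ∙ b₁)) ≡ a₁
      a\\aa₁ = begin
        component T (a ∙ (a₁ ∙ b₁)) \\ component (flipAt T i) (a ∙ (a₁ ∙ b₁))
          ≡⟨ cong₂ _\\_ (component-∙ T a∈ b∈) (cong (component (flipAt T i)) (sym (assoc a a₁ b₁))) ⟩
        a \\ component (flipAt T i) ((a ∙ a₁) ∙ b₁)
          ≡⟨ cong (a \\_) (component-∙ (flipAt T i) (∙∈prodSetsOn-⊔ pairwiseCommuting T⊔⁅i⁆ a∈ a₁∈) b₁∈) ⟩
        a \\ (a ∙ a₁)
          ≡⟨ \\-leftDividesʳ a a₁ ⟩
        a₁ ∎
        where open ≡-Reasoning

    component-flipAt : ∀ T i {γ} → γ ∈ P ⊤ → component T γ \\ component (flipAt T i) γ ∈ A i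
    component-flipAt T i {γ} γ∈ with lookup T i in Ti
    ... | false = component-flipAt-∉ T i Ti γ∈
    ... | true  = ∈-resp-≡ swap (inv-closed i _ (component-flipAt-∉ (flipAt T i) i flipAt-Ti γ∈))
      where
      flipAt-Ti : lookup (flipAt T i) i ≡ false
      flipAt-Ti = trans (lookup∘updateAt i T) (cong not Ti)
      swap : (component (flipAt T i) γ \\ component (flipAt (flipAt T i) i) γ) ⁻¹
           ≡ component T γ \\ component (flipAt T i) γ
      swap = trans (⁻¹-anti-homo-\\ _ _)
                   (cong (λ T′ → component T′ γ \\ component (flipAt T i) γ) (flipAt-involutive T i))

    cubeFace : Fin n → Subset k → Fin n → Subset k → Fin n
    cubeFace g z γ x = g ∙ component (z ⊕ x) γ

    cubeFace-isFace : ∀ g z {γ} → γ ∈ P ⊤ → IsFace G A (cubeFace g z γ)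
    cubeFace-isFace g z {γ} γ∈ x i = ∈-resp-≡
      (sym (trans (∙-\\-∙ g _ _) (cong (λ T → component (z ⊕ x) γ \\ component T γ) (⊕-flipAt z x i))))
      (component-flipAt (z ⊕ x) i γ∈)

    face≡cubeFace : ∀ {f} → IsFace G A f → ∀ z x → f x ≡ cubeFace (f z) z (f z \\ f (∁ z)) x
    face≡cubeFace {f} F z x = sym (begin
      f z ∙ component (z ⊕ x) (f z \\ f (∁ z))
        ≡⟨ cong (λ γ → f z ∙ component (z ⊕ x) γ) (\\-chain (f z) (f x) (f (∁ z))) ⟨
      f z ∙ component (z ⊕ x) ((f z \\ f x) ∙ (f x \\ f (∁ z)))
        ≡⟨ cong (f z ∙_) (component-∙ (z ⊕ x) (face-\\∈prodSetsOn F z x) x→∁z∈) ⟩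
      f z ∙ (f z \\ f x)
        ≡⟨ \\-leftDividesˡ (f z) (f x) ⟩
      f x ∎)
      where
      open ≡-Reasoning
      x→∁z∈ : f x \\ f (∁ z) ∈ P (∁ (z ⊕ x))
      x→∁z∈ = subst (λ T → f x \\ f (∁ z) ∈ P T) (x⊕∁y≡∁[y⊕x] x z) (face-\\∈prodSetsOn F x (∁ z))

    module _ (nonempty : ∀ i → Nonempty (A i)) where
      prodSetsOn-factorˡ-unique-⊔ : ∀ {X Y Z} → X ⊔ Y ≡ Z → ∀ {a a′ b b′} → a ∈ P X → a′ ∈ P X →
                                    b ∈ P Y → b′ ∈ P Y → a ∙ b ≡ a′ ∙ b′ → a ≡ a′
      prodSetsOn-factorˡ-unique-⊔ {X} {Y} {Z} X⊔Y {a} {a′} {b} {b′} a∈ a′∈ b∈ b′∈ ab≡a′b′ =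
        prodSetsOn-factorˡ-unique X a∈ a′∈ (extend b∈) (extend b′∈)
          (trans (sym (assoc a b c)) (trans (cong (_∙ c) ab≡a′b′) (assoc a′ b′ c)))
        where
        -- pad the Y-factors with a fixed element of P (∁ Z) to reach P (∁ X)
        c : Fin n
        c = proj₁ (prodSetsOn-nonempty A nonempty (∁ Z))
        extend : ∀ {d} → d ∈ P Y → d ∙ c ∈ P (∁ X)
        extend d∈ = ∙∈prodSetsOn-⊔ pairwiseCommuting (⊔-∁ X⊔Y) d∈
                                   (proj₂ (prodSetsOn-nonempty A nonempty (∁ Z)))

      ∣prodSetsOn∣≡∏On : ∀ T → ∣ P T ∣ ≡ ∏On ∣A∣ T
      ∣prodSetsOn∣≡∏On T = ≤-antisym (∣prodSetsOn∣≤∏On A T)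
        (*-cancelʳ-≤ _ _ (∏On ∣A∣ (∁ T)) {{∏On-nonZero ∣A∣ ∣A∣≢0 (∁ T)}} (begin
          ∏On ∣A∣ T * ∏On ∣A∣ (∁ T)  ≤⟨ ∏On≤∣P·P∁∣ T ⟩
          ∣ _·_ G (P T) (P (∁ T)) ∣  ≡⟨ ∣P·P∁∣≡∣P∣*∣P∁∣ T ⟩
          ∣ P T ∣ * ∣ P (∁ T) ∣      ≤⟨ *-monoʳ-≤ ∣ P T ∣ (∣prodSetsOn∣≤∏On A (∁ T)) ⟩
          ∣ P T ∣ * ∏On ∣A∣ (∁ T)    ∎))
        where
        open ≤-Reasoning
        ∣A∣≢0 : ∀ i → NonZero (∣A∣ i)
        ∣A∣≢0 i = nonZeroIndex (indexOf (A i) (proj₂ (nonempty i)))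

      agreement-flipClosed : ∀ {f f′} → IsFace G A f → IsFace G A f′ → FlipClosed (λ x → f x ≡ f′ x)
      agreement-flipClosed {f} {f′} F F′ {x} {y} i fx≡f′x fy≡f′y xi≢yi =
        ∙-cancelˡ (f x ⁻¹) _ _ (trans first-steps (cong (_\\ f′ (flipAt x i)) (sym fx≡f′x)))
        where
        -- x → flipAt x i → y: the first step lies in A i, the rest in P (flipAt x i ⊕ y)
        first-steps : f x \\ f (flipAt x i) ≡ f′ x \\ f′ (flipAt x i)
        first-steps = prodSetsOn-factorˡ-unique-⊔ (⁅i⁆⊔[flipAt⊕]≡⊕ x y i xi≢yi)
          (Equivalence.from (∈prodSetsOn-⁅⁆⇔ A i) (F x i))
          (Equivalence.from (∈prodSetsOn-⁅⁆⇔ A i) (F′ x i))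
          (face-\\∈prodSetsOn F (flipAt x i) y) (face-\\∈prodSetsOn F′ (flipAt x i) y)
          (trans (\\-chain _ _ _) (trans (cong₂ _\\_ fx≡f′x fy≡f′y) (sym (\\-chain _ _ _))))

  module _ {k m} (U : Fin (suc m) → Vtx G k) where
    private
      x : Fin (suc m) → Subset k
      x t = proj₂ (U t)

    ∈S⇒ : ∀ {i} → i ∈ S G U → ∃ λ t → lookup (x zero) i ≢ lookup (x t) i
    ∈S⇒ {i} i∈S with s , t , xsi≢xti ← Equivalence.to (∈tabulate⌊⌋⇔ _) i∈S
                 with lookup (x s) i ≟ᵇ lookup (x zero) i
    ... | yes xsi≡x₀i = t , λ x₀i≡xti → xsi≢xti (trans xsi≡x₀i x₀i≡xti)
    ... | no xsi≢x₀i  = s , xsi≢x₀i ∘ sym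

    x₀⊕x⊆S : ∀ t → x zero ⊕ x t ⊆ S G U
    x₀⊕x⊆S t i∈ = Equivalence.from (∈tabulate⌊⌋⇔ _) (zero , t , ∈⊕⇒≢ i∈)

    InC⇔ : ∀ {y} → InC G U y ⇔ (∃ λ D → D ⊆ S G U × y ≡ x zero ⊕ D)
    InC⇔ = mk⇔
      (λ (b , b⊆S , y≡) →
        tabulate b , (λ {i} i∈ → b⊆S i (trans (sym (lookup∘tabulate b i)) ([]=⇒lookup i∈))) , y≡)
      (λ (D , D⊆S , y≡) → lookup D , (λ i Di → D⊆S (lookup⇒[]= i D Di)) ,
                           trans y≡ (cong (x zero ⊕_) (sym (tabulate∘lookup D))))

    Contains⇒CContains : ∀ {f} → Contains G f U → CContains G f U
    Contains⇒CContains fU t =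
      Equivalence.from InC⇔ (x zero ⊕ x t , x₀⊕x⊆S t , sym (x⊕[x⊕y]≡y (x zero) (x t))) , fU t

  module _ {k} {A : Fin k → Subset n} (cubical : IsCubical G k A) {m} (U : Fin (suc m) → Vtx G k) where
    open Cubical cubical

    private
      P : Subset k → Subset n
      P = prodSetsOn A

      z : Subset k
      z = proj₂ (U zero)

      g₁ : Fin n
      g₁ = proj₁ (U zero)

      SU : Subset k
      SU = S G U

    CFace-unique : ∀ f f′ → IsFace G A f → IsFace G A f′ →
                   CContains G f U → CContains G f′ U → SameCFace G U f f′
    CFace-unique f f′ F F′ fU f′U y y∈C with D , D⊆S , refl ← Equivalence.to (InC⇔ U) y∈C =
      flipClosed-⊕ {E = λ x → f x ≡ f′ x} closed {z} D (agree zero) neighbour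
      where
      closed : FlipClosed (λ x → f x ≡ f′ x)
      closed = agreement-flipClosed (face⇒nonempty F) F F′
      agree : ∀ t → f (proj₂ (U t)) ≡ f′ (proj₂ (U t))
      agree t = trans (proj₂ (fU t)) (sym (proj₂ (f′U t)))
      neighbour : ∀ {i} → i ∈ D → f (flipAt z i) ≡ f′ (flipAt z i)
      neighbour {i} i∈D with t , zi≢xti ← ∈S⇒ U (D⊆S i∈D) = closed i (agree zero) (agree t) zi≢xti

    module Counting {f₀} (F₀ : IsFace G A f₀) (f₀U : CContains G f₀ U) where
      private
        nonempty : ∀ i → Nonempty (A i)
        nonempty = face⇒nonempty F₀

        δ₀ : Fin n
        δ₀ = f₀ z \\ f₀ (z ⊕ SU)

        δ₀∈ : δ₀ ∈ P SU
        δ₀∈ = subst (λ T → δ₀ ∈ P T) (x⊕[x⊕y]≡y z SU) (face-\\∈prodSetsOn F₀ z (z ⊕ SU))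

      faceOf : Fin n → Subset k → Fin n
      faceOf β = cubeFace g₁ z (δ₀ ∙ β)

      coordinate : (Subset k → Fin n) → Fin n
      coordinate f = f (z ⊕ SU) \\ f (∁ z)

      δ₀∙∈ : ∀ {β} → β ∈ P (∁ SU) → δ₀ ∙ β ∈ P ⊤
      δ₀∙∈ β∈ = ∙∈prodSetsOn-⊔ pairwiseCommuting (X⊔∁X≡⊤ SU) δ₀∈ β∈

      component-δ₀∙ : ∀ {β} → β ∈ P (∁ SU) → ∀ {D} → D ⊆ SU → component D (δ₀ ∙ β) ≡ f₀ z \\ f₀ (z ⊕ D)
      component-δ₀∙ {β} β∈ {D} D⊆S = begin
        component D (δ₀ ∙ β)
          ≡⟨ cong (λ γ → component D (γ ∙ β)) (\\-chain (f₀ z) (f₀ (z ⊕ D)) (f₀ (z ⊕ SU))) ⟨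
        component D (((f₀ z \\ f₀ (z ⊕ D)) ∙ (f₀ (z ⊕ D) \\ f₀ (z ⊕ SU))) ∙ β)
          ≡⟨ cong (component D) (assoc _ _ β) ⟩
        component D ((f₀ z \\ f₀ (z ⊕ D)) ∙ ((f₀ (z ⊕ D) \\ f₀ (z ⊕ SU)) ∙ β))
          ≡⟨ component-∙ D z→D∈ D→SU∙β∈ ⟩
        f₀ z \\ f₀ (z ⊕ D) ∎
        where
        open ≡-Reasoning
        z→D∈ : f₀ z \\ f₀ (z ⊕ D) ∈ P D
        z→D∈ = subst (λ T → f₀ z \\ f₀ (z ⊕ D) ∈ P T) (x⊕[x⊕y]≡y z D) (face-\\∈prodSetsOn F₀ z (z ⊕ D))
        D→SU∈ : f₀ (z ⊕ D) \\ f₀ (z ⊕ SU) ∈ P (D ⊕ SU)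
        D→SU∈ = subst (λ T → f₀ (z ⊕ D) \\ f₀ (z ⊕ SU) ∈ P T) ([x⊕y]⊕[x⊕z]≡y⊕z z D SU)
                      (face-\\∈prodSetsOn F₀ (z ⊕ D) (z ⊕ SU))
        D→SU∙β∈ : (f₀ (z ⊕ D) \\ f₀ (z ⊕ SU)) ∙ β ∈ P (∁ D)
        D→SU∙β∈ = ∙∈prodSetsOn-⊔ pairwiseCommuting (⊔-∁ (⊆⇒X⊔[X⊕Y]≡Y D⊆S)) D→SU∈ β∈

      faceOf-contains : ∀ {β} → β ∈ P (∁ SU) → Contains G (faceOf β) U
      faceOf-contains {β} β∈ t = begin
        g₁ ∙ component (z ⊕ x) (δ₀ ∙ β)  ≡⟨ cong (g₁ ∙_) (component-δ₀∙ β∈ (x₀⊕x⊆S U t)) ⟩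
        g₁ ∙ (f₀ z \\ f₀ (z ⊕ (z ⊕ x)))  ≡⟨ cong₂ (λ g y → g₁ ∙ (g \\ f₀ y)) (proj₂ (f₀U zero)) (x⊕[x⊕y]≡y z x) ⟩
        g₁ ∙ (g₁ \\ f₀ x)                ≡⟨ \\-leftDividesˡ g₁ (f₀ x) ⟩
        f₀ x                             ≡⟨ proj₂ (f₀U t) ⟩
        proj₁ (U t)                      ∎
        where
        open ≡-Reasoning
        x = proj₂ (U t)

      coordinate∈ : ∀ {f} → IsFace G A f → coordinate f ∈ P (∁ SU)
      coordinate∈ {f} F =
        subst (λ T → coordinate f ∈ P T) (trans (x⊕∁y≡∁[y⊕x] (z ⊕ SU) z) (cong ∁ (x⊕[x⊕y]≡y z SU)))
              (face-\\∈prodSetsOn F (z ⊕ SU) (∁ z))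

      coordinate-faceOf : ∀ {β} → β ∈ P (∁ SU) → coordinate (faceOf β) ≡ β
      coordinate-faceOf {β} β∈ = begin
        (g₁ ∙ component (z ⊕ (z ⊕ SU)) γ) \\ (g₁ ∙ component (z ⊕ ∁ z) γ)
          ≡⟨ ∙-\\-∙ g₁ _ _ ⟩
        component (z ⊕ (z ⊕ SU)) γ \\ component (z ⊕ ∁ z) γ
          ≡⟨ cong₂ (λ T T′ → component T γ \\ component T′ γ) (x⊕[x⊕y]≡y z SU) (x⊕∁x≡⊤ z) ⟩
        component SU γ \\ component ⊤ γ
          ≡⟨ cong₂ _\\_ (component-∙ SU δ₀∈ β∈) (component-⊤ (δ₀∙∈ β∈)) ⟩
        δ₀ \\ (δ₀ ∙ β)
          ≡⟨ \\-leftDividesʳ δ₀ β ⟩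
        β ∎
        where
        open ≡-Reasoning
        γ = δ₀ ∙ β

      faceOf-coordinate : ∀ {f} → IsFace G A f → Contains G f U → ∀ x → faceOf (coordinate f) x ≡ f x
      faceOf-coordinate {f} F fU x = begin
        g₁ ∙ component (z ⊕ x) (δ₀ ∙ coordinate f)
          ≡⟨ cong₂ (λ g γ → g ∙ component (z ⊕ x) γ) (sym (fU zero)) δ₀∙coordinate ⟩
        f z ∙ component (z ⊕ x) (f z \\ f (∁ z))
          ≡⟨ face≡cubeFace F z x ⟨
        f x ∎
        where
        open ≡-Reasoning
        agree : SameCFace G U f₀ f
        agree = CFace-unique f₀ f F₀ F f₀U (Contains⇒CContains U {f} fU)
        z⊕SU∈C : InC G U (z ⊕ SU)
        z⊕SU∈C = Equivalence.from (InC⇔ U) (SU , ⊆-refl , refl)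
        δ₀∙coordinate : δ₀ ∙ coordinate f ≡ f z \\ f (∁ z)
        δ₀∙coordinate = trans
          (cong₂ (λ g h → (g \\ h) ∙ coordinate f) (trans (proj₂ (f₀U zero)) (sym (fU zero))) (agree (z ⊕ SU) z⊕SU∈C))
          (\\-chain (f z) (f (z ⊕ SU)) (f (∁ z)))

      members↔faces : Inverse (Members (P (∁ SU))) (FacesContaining G A U)
      members↔faces = record
        { to        = λ (β , β∈) → faceOf β , cubeFace-isFace g₁ z (δ₀∙∈ β∈) , faceOf-contains β∈
        ; from      = λ (f , F , _) → coordinate f , coordinate∈ F
        ; to-cong   = λ { refl x → refl }
        ; from-cong = λ f≗f′ → cong₂ _\\_ (f≗f′ (z ⊕ SU)) (f≗f′ (∁ z))
        ; inverse   = (λ { {f , F , fU} {β , β∈} refl → faceOf-coordinate F fU })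
                    , (λ { {β , β∈} f≗ → trans (cong₂ _\\_ (f≗ (z ⊕ SU)) (f≗ (∁ z))) (coordinate-faceOf β∈) })
        }

      countOutsideS≡∣P∁S∣ : countOutsideS G A U ≡ ∣ P (∁ SU) ∣
      countOutsideS≡∣P∁S∣ = trans (∏-if-∈≡∏On∁ (∣_∣ ∘ A) SU) (sym (∣prodSetsOn∣≡∏On nonempty (∁ SU)))

      faces↔ : Inverse (setoid (Fin (countOutsideS G A U))) (FacesContaining G A U)
      faces↔ = subst (λ N → Inverse (setoid (Fin N)) (FacesContaining G A U)) (sym countOutsideS≡∣P∁S∣)
        (Compose.inverse (Fin∣p∣↔Members (P (∁ SU))) members↔faces)

lemma3p3 : (G : FinGroup) (k : ℕ) (A : Fin k → Subset (FinGroup.n G))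
    → IsCubical G k A
    → (m : ℕ) (U : Fin (suc m) → Vtx G k)
    → ((f f' : Vec Bool k → Fin (FinGroup.n G))
        → IsFace G A f → IsFace G A f'
        → CContains G f U → CContains G f' U
        → SameCFace G U f f')
      × (Σ (Vec Bool k → Fin (FinGroup.n G)) (λ f → IsFace G A f × CContains G f U)
        → Inverse (setoid (Fin (countOutsideS G A U))) (FacesContaining G A U))
lemma3p3 G k A cubical m U =
  CFace-unique G cubical U , λ (f₀ , F₀ , f₀U) → Counting.faces↔ G cubical U F₀ f₀U
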